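{- The set of elementary functions $\mathcal{E}$ equals the set of functions with values in $\mathbb{N}$ (i.e. of the form $\mathbb{N}^p\to\mathbb{N}$) belonging to the smallest class of functions that contains the zero function $\mathbf{0}$, the projections $\pi^p_i$, the successor $s$, addition $+$ and subtraction $-$ (on $\mathbb{Z}$), and that is closed under composition and the discrete linear ODE scheme $\mathrm{LI}$. The same holds if the (vectorial) linear ODE scheme is replaced by the scalar discrete linear ODE scheme.
   Context: The class $\mathcal{E}$ of elementary functions is the smallest class of functions $\mathbb{N}^p\to\mathbb{N}$ containing $\mathbf 0$, the projections, the successor $s(n)=n+1$, addition, truncated subtraction $(n_1,n_2)\mapsto\max(0,n_1-n_2)$, and closed under composition, bounded sum $(x,\mathbf y)\mapsto\sum_{z\le x}g(z,\mathbf y)$ and bounded product $(x,\mathbf y)\mapsto\prod_{z\le x}g(z,\mathbf y)$. Discrete derivative: $\frac{\delta f(x,\mathbf y)}{\delta x}=f(x+1,\mathbf y)-f(x,\mathbf y)$. Linear ODE scheme $\mathrm{LI}$: given $\mathbf G=(g_i)_{1\le i\le k}$ with $g_i:\mathbb{N}^p\to\mathbb{N}$, a $k\times k$ matrix $\mathbf A=(a_{i,j})$ and a vector $\mathbf B=(b_i)$ with $a_{i,j},b_i:\mathbb{N}^{p+1}\to\mathbb{Z}$, $\mathbf f=\mathrm{LI}(\mathbf G,\mathbf A,\mathbf B):\mathbb{N}^{p+1}\to\mathbb{Z}^k$ is the unique solution of $\frac{\delta \mathbf f(x,\mathbf y)}{\delta x}=\mathbf A(x,\mathbf y)\cdot\mathbf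 f(x,\mathbf y)+\mathbf B(x,\mathbf y)$, $\mathbf f(0,\mathbf y)=\mathbf G(\mathbf y)$. The scalar scheme is the case $k=1$. -}

module Defs where

open import Data.Nat as ℕ using (ℕ; zero; suc; _∸_)
open import Data.Integer as ℤ using (ℤ; +_; ∣_∣)
open import Data.Fin using (Fin; zero; suc)
open import Data.Vec.Functional using (_∷_; tail)
open import Data.Product using (∃; _×_)
open import Data.Unit using (⊤)
open import Relation.Binary.PropositionalEquality using (_≡_)

sumTo : (ℕ → ℕ) → ℕ → ℕ
sumTo g zero    = g zero
sumTo g (suc x) = sumTo g x ℕ.+ g (suc x)

prodTo : (ℕ → ℕ) → ℕ → ℕ
prodTo g zero    = g zero
prodTo g (suc x) = prodTo g x ℕ.* g (suc x)

data Elem : (p : ℕ) → ((Fin p → ℕ) → ℕ) → Set where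
  zeroE  : ∀ {p} → Elem p (λ _ → 0)
  projE  : ∀ {p} (i : Fin p) → Elem p (λ y → y i)
  succE  : Elem 1 (λ y → suc (y zero))
  addE   : Elem 2 (λ y → y zero ℕ.+ y (suc zero))
  monusE : Elem 2 (λ y → y zero ∸ y (suc zero))
  compE  : ∀ {m p} {h : (Fin m → ℕ) → ℕ} {g : Fin m → (Fin p → ℕ) → ℕ} →
           Elem m h → ((i : Fin m) → Elem p (g i)) →
           Elem p (λ y → h (λ i → g i y))
  bsumE  : ∀ {p} {g : (Fin (suc p) → ℕ) → ℕ} → Elem (suc p) g →
           Elem (suc p) (λ xy → sumTo (λ z → g (z ∷ tail xy)) (xy zero))
  bprodE : ∀ {p} {g : (Fin (suc p) → ℕ) → ℕ} → Elem (suc p) g →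
           Elem (suc p) (λ xy → prodTo (λ z → g (z ∷ tail xy)) (xy zero))

data Sort : Set where
  N Z : Sort

⟦_⟧ : Sort → Set
⟦ N ⟧ = ℕ
⟦ Z ⟧ = ℤ

Env : ∀ {p} → (Fin p → Sort) → Set
Env {p} σ = (i : Fin p) → ⟦ σ i ⟧

sumFin : ∀ {k} → (Fin k → ℤ) → ℤ
sumFin {zero}  v = + 0
sumFin {suc k} v = v zero ℤ.+ sumFin (λ j → v (suc j))

-- Solution of the discrete linear ODE
--   f(x+1,y) - f(x,y) = A(x,y) f(x,y) + B(x,y),  f(0,y) = G(y)
-- LIsol G A B x y i = i-th component of f(x,y).
LIsol : ∀ {p k} →
        (Fin k → (Fin p → ℕ) → ℕ) →
        (Fin k → Fin k → (Fin (suc p) → ℕ) → ℤ) →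
        (Fin k → (Fin (suc p) → ℕ) → ℤ) →
        ℕ → (Fin p → ℕ) → Fin k → ℤ
LIsol G A B zero    y i = + G i y
LIsol G A B (suc x) y i =
  LIsol G A B x y i ℤ.+
    (sumFin (λ j → A i j (x ∷ y) ℤ.* LIsol G A B x y j) ℤ.+ B i (x ∷ y))

-- A function is "ℕ-valued" (output sort N) if its values lie in ℕ; the
-- constructors toZ / toN express that a ℕ-valued function is ℤ-valued and
-- a ℤ-valued function all of whose values are ≥ 0 is ℕ-valued.
data LIClass (allowed : ℕ → Set) :
       {p : ℕ} (σ : Fin p → Sort) (s : Sort) → (Env σ → ⟦ s ⟧) → Set where
  zeroL  : ∀ {p} {σ : Fin p → Sort} → LIClass allowed σ N (λ _ → 0)
  projL  : ∀ {p} {σ : Fin p → Sort} (i : Fin p) →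
           LIClass allowed σ (σ i) (λ e → e i)
  succL  : LIClass allowed {1} (λ _ → N) N (λ e → suc (e zero))
  plusL  : LIClass allowed {2} (λ _ → Z) Z (λ e → e zero ℤ.+ e (suc zero))
  minusL : LIClass allowed {2} (λ _ → Z) Z (λ e → e zero ℤ.- e (suc zero))
  toZ    : ∀ {p} {σ : Fin p → Sort} {f : Env σ → ℕ} →
           LIClass allowed σ N f → LIClass allowed σ Z (λ e → + f e)
  toN    : ∀ {p} {σ : Fin p → Sort} {f : Env σ → ℤ} →
           LIClass allowed σ Z f → (∀ e → + 0 ℤ.≤ f e) →
           LIClass allowed σ N (λ e → ∣ f e ∣)
  compL  : ∀ {m p} {σ : Fin p → Sort} {τ : Fin m → Sort} {s : Sort}
             {h : Env τ → ⟦ s ⟧} {g : (i : Fin m) → Env σ → ⟦ τ i ⟧} →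
           LIClass allowed τ s h → ((i : Fin m) → LIClass allowed σ (τ i) (g i)) →
           LIClass allowed σ s (λ e → h (λ i → g i e))
  liL    : ∀ {p k} → allowed k →
           {G : Fin k → (Fin p → ℕ) → ℕ}
           {A : Fin k → Fin k → (Fin (suc p) → ℕ) → ℤ}
           {B : Fin k → (Fin (suc p) → ℕ) → ℤ} →
           ((i : Fin k) → LIClass allowed (λ _ → N) N (G i)) →
           ((i j : Fin k) → LIClass allowed (λ _ → N) Z (A i j)) →
           ((i : Fin k) → LIClass allowed (λ _ → N) Z (B i)) →
           (i : Fin k) →
           LIClass allowed (λ _ → N) Z (λ xy → LIsol G A B (xy zero) (tail xy) i)

Vectorial : ℕ → Set
Vectorial _ = ⊤

Scalar : ℕ → Set
Scalar k = k ≡ 1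

InE : ∀ p → ((Fin p → ℕ) → ℕ) → Set
InE p f = ∃ λ g → Elem p g × (∀ y → g y ≡ f y)

InLI : (ℕ → Set) → ∀ p → ((Fin p → ℕ) → ℕ) → Set
InLI allowed p f = ∃ λ g → LIClass allowed (λ (_ : Fin p) → N) N g × (∀ y → g y ≡ f y)

module Submission where

-- Each elementary construction is a scalar linear ODE: bounded sums and products solve
-- f′ = g(x+1) and f′ = (g(x+1) - 1) f, and truncated subtraction x ∸ b is reached through the ODEs
-- for 1 ∸ x, for the equality test 1 ∸ (u - v)², for χ≤ b x (whose increments are equality tests)
-- and for x ∸ b (whose increments are comparisons).
-- Conversely, integers are coded by naturals (n ↦ 2n, -n-1 ↦ 2n+1), which makes ring operations
-- elementary on codes. A solution of a k-dimensional linear ODE is bounded up to time x by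
-- (1 + Σ|G|) Π_{u ≤ x} (1 + Σ|A(u)| + Σ|B(u)|), an elementary function, so the codes of f(t)
-- are the digits of one number in an elementary base, updated by an elementary step. Elementary
-- functions are closed under such bounded recursion: the value at x is the average of the x-th
-- digit over all numbers below an elementary bound whose digits obey the recursion.

open import Defs
open import Data.Nat using (ℕ)
open import Data.Fin using (Fin)
open import Data.Product using (_×_)
open import Function.Bundles using (_⇔_; mk⇔)
open import Data.Unit using (tt)

open import Data.Nat using (zero; suc; _+_; _*_; _∸_; _^_; _≤_; _<_; z≤n; s≤s; _≤?_; _≟_; NonZero; >-nonZero)
open import Data.Nat.Properties
open import Data.Nat.DivMod
import Data.Nat.Tactic.RingSolver as ℕ-Solver
open import Algebra.Properties.Semiring.Sum +-*-semiring using (sum; sum-syntax; sum-cong-≗; ∑-distrib-+; *-distribʳ-sum)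
open import Data.Integer as ℤ using (ℤ; +_; -[1+_]; ∣_∣; _⊖_; +≤+)
import Data.Integer.Properties as ℤ
open import Data.Integer.Tactic.RingSolver using (solve-∀)
open import Data.Fin using (zero; suc; toℕ; fromℕ<)
open import Data.Fin.Properties using (toℕ-fromℕ<)
open import Data.Vec.Functional using (_∷_; []; tail)
open import Data.Product using (∃; _,_; proj₁; proj₂)
open import Relation.Nullary using (yes; no; contradiction)
open import Data.Sum using (inj₁; inj₂)
open import Function using (_∘_)
open import Relation.Binary.PropositionalEquality
open import Relation.Binary.Definitions using (tri<; tri≈; tri>)

Fn Fnℤ : ℕ → Set
Fn p   = (Fin p → ℕ) → ℕ
Fnℤ p  = (Fin p → ℕ) → ℤ

sumTo-cong : ∀ {f g : ℕ → ℕ} → f ≗ g → ∀ n → sumTo f n ≡ sumTo g n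
sumTo-cong f≗g zero    = f≗g zero
sumTo-cong f≗g (suc n) = cong₂ _+_ (sumTo-cong f≗g n) (f≗g (suc n))

prodTo-cong : ∀ {f g : ℕ → ℕ} → f ≗ g → ∀ n → prodTo f n ≡ prodTo g n
prodTo-cong f≗g zero    = f≗g zero
prodTo-cong f≗g (suc n) = cong₂ _*_ (prodTo-cong f≗g n) (f≗g (suc n))

∷-cong : ∀ {p} z {y y′ : Fin p → ℕ} → y ≗ y′ → (z ∷ y) ≗ (z ∷ y′)
∷-cong z y≗y′ zero    = refl
∷-cong z y≗y′ (suc i) = y≗y′ i

Elem-cong : ∀ {p g} → Elem p g → ∀ {y y′} → y ≗ y′ → g y ≡ g y′
Elem-cong zeroE        y≗y′ = refl
Elem-cong (projE i)    y≗y′ = y≗y′ i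
Elem-cong succE        y≗y′ = cong suc (y≗y′ zero)
Elem-cong addE         y≗y′ = cong₂ _+_ (y≗y′ zero) (y≗y′ (suc zero))
Elem-cong monusE       y≗y′ = cong₂ _∸_ (y≗y′ zero) (y≗y′ (suc zero))
Elem-cong (compE h gs) y≗y′ = Elem-cong h (λ i → Elem-cong (gs i) y≗y′)
Elem-cong (bsumE {g = g} e) {y} {y′} y≗y′ =
  trans (sumTo-cong (λ z → Elem-cong e (∷-cong z (λ i → y≗y′ (suc i)))) (y zero))
        (cong (sumTo (λ z → g (z ∷ tail y′))) (y≗y′ zero))
Elem-cong (bprodE {g = g} e) {y} {y′} y≗y′ =
  trans (prodTo-cong (λ z → Elem-cong e (∷-cong z (λ i → y≗y′ (suc i)))) (y zero))
        (cong (prodTo (λ z → g (z ∷ tail y′))) (y≗y′ zero))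

InE-cong : ∀ {p} {f : Fn p} → InE p f → ∀ {y y′} → y ≗ y′ → f y ≡ f y′
InE-cong (g , e , g≗f) {y} {y′} y≗y′ = trans (sym (g≗f y)) (trans (Elem-cong e y≗y′) (g≗f y′))

InE-≗ : ∀ {p} {f f′ : Fn p} → InE p f → f ≗ f′ → InE p f′
InE-≗ (g , e , g≗f) f≗f′ = g , e , λ y → trans (g≗f y) (f≗f′ y)

InE-∘ : ∀ {m p} {h : Fn m} {g : Fin m → Fn p} →
        InE m h → (∀ i → InE p (g i)) → InE p (λ y → h (λ i → g i y))
InE-∘ (h′ , eh , h′≗h) eg =
  (λ y → h′ (λ i → proj₁ (eg i) y)) , compE eh (λ i → proj₁ (proj₂ (eg i))) ,
  λ y → trans (Elem-cong eh (λ i → proj₂ (proj₂ (eg i)) y)) (h′≗h _)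

InE-∘₂ : ∀ {p} {op : ℕ → ℕ → ℕ} → InE 2 (λ y → op (y zero) (y (suc zero))) →
         ∀ {a b : Fn p} → InE p a → InE p b → InE p (λ y → op (a y) (b y))
InE-∘₂ eop {a} {b} ea eb = InE-∘ {g = a ∷ b ∷ []} eop λ { zero → ea ; (suc zero) → eb }

InE-∘′ : ∀ {m p} {h : Fn m} {G : (Fin p → ℕ) → Fin m → ℕ} (g : Fin m → Fn p) →
         InE m h → (∀ i → InE p (g i)) → (∀ y → (λ i → g i y) ≗ G y) → InE p (λ y → h (G y))
InE-∘′ g eh eg g≗G = InE-≗ (InE-∘ {g = g} eh eg) (λ y → InE-cong eh (g≗G y))

InE-0 : ∀ {p} → InE p (λ _ → 0)
InE-0 = _ , zeroE , λ _ → refl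

InE-π : ∀ {p} (i : Fin p) → InE p (λ y → y i)
InE-π i = _ , projE i , λ _ → refl

InE-skip₁ : ∀ {p} {F : Fn (suc p)} → InE (suc p) F → InE (suc (suc p)) (λ w → F (w zero ∷ tail (tail w)))
InE-skip₁ eF = InE-∘′ ((λ w → w zero) ∷ (λ j w → w (suc (suc j)))) eF
  (λ { zero → InE-π zero ; (suc j) → InE-π (suc (suc j)) }) (λ _ → λ { zero → refl ; (suc j) → refl })

InE-suc : ∀ {p} {a : Fn p} → InE p a → InE p (λ y → suc (a y))
InE-suc {a = a} ea = InE-∘ {g = a ∷ []} (_ , succE , λ _ → refl) λ { zero → ea }

InE-+ : ∀ {p} {a b : Fn p} → InE p a → InE p b → InE p (λ y → a y + b y)
InE-+ = InE-∘₂ {op = _+_} (_ , addE , λ _ → refl)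

InE-∸ : ∀ {p} {a b : Fn p} → InE p a → InE p b → InE p (λ y → a y ∸ b y)
InE-∸ = InE-∘₂ {op = _∸_} (_ , monusE , λ _ → refl)

InE-const : ∀ {p} n → InE p (λ _ → n)
InE-const zero    = InE-0
InE-const (suc n) = InE-suc (InE-const n)

InE-weaken : ∀ {p} {f : Fn p} → InE p f → InE (suc p) (λ xy → f (tail xy))
InE-weaken ef = InE-∘ ef (λ i → InE-π (suc i))

InE-sumTo : ∀ {p} {g : Fn (suc p)} {a : Fn p} → InE (suc p) g → InE p a →
            InE p (λ y → sumTo (λ z → g (z ∷ y)) (a y))
InE-sumTo {g = g} {a} (g′ , eg , g′≗g) ea =
  InE-≗ (InE-∘ {g = a ∷ (λ j y → y j)} (_ , bsumE eg , λ _ → refl) λ { zero → ea ; (suc j) → InE-π j })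
        (λ y → sumTo-cong (λ z → g′≗g (z ∷ y)) (a y))

InE-prodTo : ∀ {p} {g : Fn (suc p)} {a : Fn p} → InE (suc p) g → InE p a →
             InE p (λ y → prodTo (λ z → g (z ∷ y)) (a y))
InE-prodTo {g = g} {a} (g′ , eg , g′≗g) ea =
  InE-≗ (InE-∘ {g = a ∷ (λ j y → y j)} (_ , bprodE eg , λ _ → refl) λ { zero → ea ; (suc j) → InE-π j })
        (λ y → prodTo-cong (λ z → g′≗g (z ∷ y)) (a y))

sumTo-const : ∀ c n → sumTo (λ _ → c) n ≡ suc n * c
sumTo-const c zero    = sym (+-identityʳ c)
sumTo-const c (suc n) = trans (cong (_+ c) (sumTo-const c n)) (+-comm (suc n * c) c)

-- a * b = Σ_{z ≤ a} b ∸ b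
InE-* : ∀ {p} {a b : Fn p} → InE p a → InE p b → InE p (λ y → a y * b y)
InE-* {a = a} {b} ea eb =
  InE-≗ (InE-∸ (InE-sumTo (InE-weaken eb) ea) eb)
        (λ y → trans (cong (_∸ b y) (sumTo-const (b y) (a y))) (m+n∸m≡n (b y) (a y * b y)))

powFactor : ℕ → ℕ → ℕ
powFactor b zero    = 1
powFactor b (suc _) = b

powFactor-formula : ∀ b z → b * (1 ∸ (1 ∸ z)) + (1 ∸ z) ≡ powFactor b z
powFactor-formula b zero    = cong (_+ 1) (*-zeroʳ b)
powFactor-formula b (suc z) rewrite 0∸n≡0 z = trans (+-identityʳ (b * 1)) (*-identityʳ b)

prodTo-powFactor : ∀ b e → prodTo (powFactor b) e ≡ b ^ e
prodTo-powFactor b zero    = refl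
prodTo-powFactor b (suc e) = trans (cong (_* b) (prodTo-powFactor b e)) (*-comm (b ^ e) b)

InE-^ : ∀ {p} {a b : Fn p} → InE p a → InE p b → InE p (λ y → a y ^ b y)
InE-^ {a = a} {b} ea eb =
  InE-≗ (InE-prodTo (InE-+ (InE-* (InE-weaken ea) (InE-∸ one (InE-∸ one (InE-π zero)))) (InE-∸ one (InE-π zero))) eb)
        (λ y → trans (prodTo-cong (λ z → powFactor-formula (a y) z) (b y)) (prodTo-powFactor (a y) (b y)))
  where one = InE-const 1

InE-∑ : ∀ {p k} {f : Fin k → Fn p} → (∀ i → InE p (f i)) → InE p (λ y → ∑[ i < k ] f i y)
InE-∑ {k = zero}  ef = InE-0
InE-∑ {k = suc k} ef = InE-+ (ef zero) (InE-∑ (λ i → ef (suc i)))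

χ≤ : ℕ → ℕ → ℕ
χ≤ u v = 1 ∸ (u ∸ v)

χ≤-yes : ∀ {u v} → u ≤ v → χ≤ u v ≡ 1
χ≤-yes u≤v = cong (1 ∸_) (m≤n⇒m∸n≡0 u≤v)

χ≤-no : ∀ {u v} → v < u → χ≤ u v ≡ 0
χ≤-no v<u = m≤n⇒m∸n≡0 (m<n⇒0<n∸m v<u)

χ≡ : ℕ → ℕ → ℕ
χ≡ u v = χ≤ u v * χ≤ v u

χ≡-refl : ∀ u → χ≡ u u ≡ 1
χ≡-refl u rewrite χ≤-yes (≤-refl {u}) = refl

χ≡-≢ : ∀ {u v} → u ≢ v → χ≡ u v ≡ 0
χ≡-≢ {u} {v} u≢v with ≤-total u v
... | inj₁ u≤v = trans (cong (χ≤ u v *_) (χ≤-no (≤∧≢⇒< u≤v u≢v))) (*-zeroʳ (χ≤ u v))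
... | inj₂ v≤u = cong (_* χ≤ v u) (χ≤-no (≤∧≢⇒< v≤u (u≢v ∘ sym)))

χ≡≢0⇒≡ : ∀ {u v} → χ≡ u v ≢ 0 → u ≡ v
χ≡≢0⇒≡ {u} {v} χ≢0 with u ≟ v
... | yes u≡v = u≡v
... | no  u≢v = contradiction (χ≡-≢ u≢v) χ≢0

InE-χ≤ : ∀ {p} {a b : Fn p} → InE p a → InE p b → InE p (λ y → χ≤ (a y) (b y))
InE-χ≤ ea eb = InE-∸ (InE-const 1) (InE-∸ ea eb)

InE-χ≡ : ∀ {p} {a b : Fn p} → InE p a → InE p b → InE p (λ y → χ≡ (a y) (b y))
InE-χ≡ ea eb = InE-* (InE-χ≤ ea eb) (InE-χ≤ eb ea)

sumTo-ones : ∀ (f : ℕ → ℕ) n → (∀ z → z ≤ n → f z ≡ 1) → sumTo f n ≡ suc n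
sumTo-ones f zero    ones = ones 0 z≤n
sumTo-ones f (suc n) ones =
  trans (cong₂ _+_ (sumTo-ones f n (λ z z≤n → ones z (m≤n⇒m≤1+n z≤n))) (ones (suc n) ≤-refl)) (+-comm (suc n) 1)

sumTo-threshold : ∀ (f : ℕ → ℕ) q n → (∀ z → z < q → f z ≡ 1) → (∀ z → q ≤ z → f z ≡ 0) →
                  q ≤ suc n → sumTo f n ≡ q
sumTo-threshold f q n ones zeros q≤1+n with q ≤? n
sumTo-threshold f q zero    ones zeros _ | yes q≤0 = trans (zeros 0 q≤0) (sym (n≤0⇒n≡0 q≤0))
sumTo-threshold f q (suc n) ones zeros _ | yes q≤1+n =
  trans (cong₂ _+_ (sumTo-threshold f q n ones zeros q≤1+n) (zeros (suc n) q≤1+n)) (+-identityʳ q)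
... | no q≰n = trans (sumTo-ones f n (λ z z≤n → ones z (<-≤-trans (s≤s z≤n) (≰⇒> q≰n))))
                     (≤-antisym (≰⇒> q≰n) q≤1+n)

-- Total, elementary versions of _/_ and _%_ (junk value: quot a 0 = suc a), opaque so that
-- conversion checking never unfolds the large terms built from them.
opaque
  quot : ℕ → ℕ → ℕ
  quot a b = sumTo (λ z → χ≤ (suc z * b) a) a

  rem : ℕ → ℕ → ℕ
  rem a b = a ∸ quot a b * b

  quot≡/ : ∀ a b .{{_ : NonZero b}} → quot a b ≡ a / b
  quot≡/ a b = sumTo-threshold _ (a / b) a
    (λ z z<q → χ≤-yes (≤-trans (*-monoˡ-≤ b z<q) (m/n*n≤m a b)))
    (λ z q≤z → χ≤-no (begin-strict
      a                   ≡⟨ m≡m%n+[m/n]*n a b ⟩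
      a % b + a / b * b   <⟨ +-monoˡ-< (a / b * b) (m%n<n a b) ⟩
      suc (a / b) * b     ≤⟨ *-monoˡ-≤ b (s≤s q≤z) ⟩
      suc z * b           ∎))
    (m≤n⇒m≤1+n (m/n≤m a b))
    where open ≤-Reasoning

  rem≡% : ∀ a b .{{_ : NonZero b}} → rem a b ≡ a % b
  rem≡% a b = trans (cong (λ q → a ∸ q * b) (quot≡/ a b)) (sym (m%n≡m∸m/n*n a b))

  InE-quot : ∀ {p} {a b : Fn p} → InE p a → InE p b → InE p (λ y → quot (a y) (b y))
  InE-quot ea eb = InE-∘₂ {op = quot}
    (InE-sumTo (InE-χ≤ (InE-* (InE-suc (InE-π zero)) (InE-π (suc (suc zero)))) (InE-π (suc zero))) (InE-π zero))
    ea eb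

  InE-rem : ∀ {p} {a b : Fn p} → InE p a → InE p b → InE p (λ y → rem (a y) (b y))
  InE-rem ea eb = InE-∸ ea (InE-* (InE-quot ea eb) eb)

rem< : ∀ a b .{{_ : NonZero b}} → rem a b < b
rem< a b = subst (_< b) (sym (rem≡% a b)) (m%n<n a b)

rem-small : ∀ {a b} → a < b → rem a b ≡ a
rem-small {a} {suc b} a<b = trans (rem≡% a (suc b)) (m<n⇒m%n≡m a<b)

digit : ℕ → ℕ → ℕ → ℕ
digit B s t = rem (quot s (B ^ t)) B

InE-digit : ∀ {p} {B s t : Fn p} → InE p B → InE p s → InE p t → InE p (λ y → digit (B y) (s y) (t y))
InE-digit eB es et = InE-rem (InE-quot es (InE-^ eB et)) eB

module _ {B : ℕ} .{{_ : NonZero B}} where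

  digit≡ : ∀ s t → digit B s t ≡ _/_ s (B ^ t) {{m^n≢0 B t}} % B
  digit≡ s t = trans (cong (λ q → rem q B) (quot≡/ s (B ^ t) {{m^n≢0 B t}})) (rem≡% _ B)

  [a+h*B]%B≡a : ∀ {a} h → a < B → (a + h * B) % B ≡ a
  [a+h*B]%B≡a {a} h a<B = trans ([m+kn]%n≡m%n a h B) (m<n⇒m%n≡m a<B)

  [a+h*B]/B≡h : ∀ {a} h → a < B → (a + h * B) / B ≡ h
  [a+h*B]/B≡h {a} h a<B = begin
    (a + h * B) / B   ≡⟨ +-distrib-/ a (h * B) (subst (_< B) (sym remainders) a<B) ⟩
    a / B + h * B / B ≡⟨ cong₂ _+_ (m<n⇒m/n≡0 a<B) (m*n/n≡m h B) ⟩
    h                 ∎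
    where
    open ≡-Reasoning
    remainders : a % B + h * B % B ≡ a
    remainders = trans (cong₂ _+_ (m<n⇒m%n≡m a<B) (m*n%n≡0 h B)) (+-identityʳ a)

  digit-zero : ∀ {a} h → a < B → digit B (a + h * B) 0 ≡ a
  digit-zero {a} h a<B = begin
    digit B (a + h * B) 0    ≡⟨ digit≡ (a + h * B) 0 ⟩
    (a + h * B) / 1 % B      ≡⟨ cong (_% B) (n/1≡n (a + h * B)) ⟩
    (a + h * B) % B          ≡⟨ [a+h*B]%B≡a h a<B ⟩
    a                        ∎
    where open ≡-Reasoning

  digit-suc : ∀ {a} h t → a < B → digit B (a + h * B) (suc t) ≡ digit B h t
  digit-suc {a} h t a<B = begin
    digit B (a + h * B) (suc t) ≡⟨ digit≡ (a + h * B) (suc t) ⟩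
    _/_ (a + h * B) (B ^ suc t) {{m^n≢0 B (suc t)}} % B
      ≡⟨ cong (_% B) (m/n/o≡m/[n*o] (a + h * B) B (B ^ t) {{_}} {{m^n≢0 B t}} {{m^n≢0 B (suc t)}}) ⟨
    _/_ ((a + h * B) / B) (B ^ t) {{m^n≢0 B t}} % B
      ≡⟨ cong (λ q → _/_ q (B ^ t) {{m^n≢0 B t}} % B) ([a+h*B]/B≡h h a<B) ⟩
    _/_ h (B ^ t) {{m^n≢0 B t}} % B ≡⟨ digit≡ h t ⟨
    digit B h t                       ∎
    where open ≡-Reasoning

-- Base-B positional codes of finite sequences

horner : ℕ → ∀ {k} → (Fin k → ℕ) → ℕ
horner B {zero}  d = 0
horner B {suc k} d = d zero + horner B (tail d) * B

horner-cong : ∀ B {k} {d d′ : Fin k → ℕ} → d ≗ d′ → horner B d ≡ horner B d′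
horner-cong B {zero}  d≗d′ = refl
horner-cong B {suc k} d≗d′ = cong₂ (λ a h → a + h * B) (d≗d′ zero) (horner-cong B (λ i → d≗d′ (suc i)))

module _ {B : ℕ} .{{_ : NonZero B}} where

  digit-horner : ∀ {k} (d : Fin k → ℕ) → (∀ i → d i < B) → ∀ i → digit B (horner B d) (toℕ i) ≡ d i
  digit-horner d d<B zero    = digit-zero (horner B (tail d)) (d<B zero)
  digit-horner d d<B (suc i) =
    trans (digit-suc (horner B (tail d)) (toℕ i) (d<B zero)) (digit-horner (tail d) (λ j → d<B (suc j)) i)

  horner-< : ∀ {k} (d : Fin k → ℕ) → (∀ i → d i < B) → horner B d < B ^ k
  horner-< {zero}  d d<B = s≤s z≤n
  horner-< {suc k} d d<B = begin-strict
    d zero + horner B (tail d) * B <⟨ +-monoˡ-< _ (d<B zero) ⟩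
    suc (horner B (tail d)) * B    ≤⟨ *-monoˡ-≤ B (horner-< (tail d) (λ i → d<B (suc i))) ⟩
    B ^ k * B                      ≡⟨ *-comm (B ^ k) B ⟩
    B ^ suc k                      ∎
    where open ≤-Reasoning

InE-horner : ∀ {p k} {B : Fn p} {d : Fin k → Fn p} → InE p B → (∀ i → InE p (d i)) →
             InE p (λ y → horner (B y) (λ i → d i y))
InE-horner {k = zero}  eB ed = InE-0
InE-horner {k = suc k} eB ed = InE-+ (ed zero) (InE-* (InE-horner eB (λ i → ed (suc i))) eB)

-- Bounded primitive recursion

rec : ∀ {p} → Fn p → Fn (suc (suc p)) → ℕ → Fn p
rec g h zero    y = g y
rec g h (suc t) y = h (t ∷ rec g h t y ∷ y)

sumTo-≤ : ∀ f n {z} → z ≤ n → f z ≤ sumTo f n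
sumTo-≤ f zero    z≤n = ≤-refl
sumTo-≤ f (suc n) z≤1+n with m≤n⇒m<n∨m≡n z≤1+n
... | inj₁ z<1+n = ≤-trans (sumTo-≤ f n (m<1+n⇒m≤n z<1+n)) (m≤m+n _ _)
... | inj₂ refl  = m≤n+m _ _

sumTo-*ʳ : ∀ f c n → sumTo (λ s → f s * c) n ≡ sumTo f n * c
sumTo-*ʳ f c zero    = refl
sumTo-*ʳ f c (suc n) = trans (cong (_+ f (suc n) * c) (sumTo-*ʳ f c n)) (sym (*-distribʳ-+ c (sumTo f n) (f (suc n))))

quot-weighted : ∀ (w v : ℕ → ℕ) c n → (∀ s → w s * v s ≡ w s * c) → 0 < sumTo w n →
                quot (sumTo (λ s → w s * v s) n) (sumTo w n) ≡ c
quot-weighted w v c n wv≡wc 0<W = begin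
  quot (sumTo (λ s → w s * v s) n) W ≡⟨ cong (λ a → quot a W) (trans (sumTo-cong wv≡wc n) (sumTo-*ʳ w c n)) ⟩
  quot (W * c) W                     ≡⟨ quot≡/ (W * c) W {{>-nonZero 0<W}} ⟩
  _/_ (W * c) W {{>-nonZero 0<W}}    ≡⟨ cong (λ a → _/_ a W {{>-nonZero 0<W}}) (*-comm W c) ⟩
  _/_ (c * W) W {{>-nonZero 0<W}}    ≡⟨ m*n/n≡m c W {{>-nonZero 0<W}} ⟩
  c                                  ∎
  where
  open ≡-Reasoning
  W = sumTo w n

prodTo≢0 : ∀ f x → prodTo f x ≢ 0 → ∀ t → t ≤ x → f t ≢ 0
prodTo≢0 f zero    Π≢0 zero z≤n = Π≢0
prodTo≢0 f (suc x) Π≢0 t t≤1+x with m≤n⇒m<n∨m≡n t≤1+x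
... | inj₁ t<1+x = prodTo≢0 f x (λ Π≡0 → Π≢0 (cong (_* f (suc x)) Π≡0)) t (m<1+n⇒m≤n t<1+x)
... | inj₂ refl  = λ f≡0 → Π≢0 (trans (cong (prodTo f x *_) f≡0) (*-zeroʳ (prodTo f x)))

prodTo-ones : ∀ f x → (∀ t → t ≤ x → f t ≡ 1) → prodTo f x ≡ 1
prodTo-ones f zero    ones = ones 0 z≤n
prodTo-ones f (suc x) ones =
  cong₂ _*_ (prodTo-ones f x (λ t t≤x → ones t (m≤n⇒m≤1+n t≤x))) (ones (suc x) ≤-refl)

module BoundedRecursion {p} (g : Fn p) (h : Fn (suc (suc p))) (b : Fn p) where

  base : Fn p
  base y = suc (b y)

  dig : ℕ → ℕ → Fn p
  dig s t y = digit (base y) s t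

  stepsOk : ℕ → ℕ → Fn p
  stepsOk s x y = prodTo (λ t → χ≡ (dig s (suc t) y) (h (t ∷ dig s t y ∷ y))) x

  isTrace : ℕ → ℕ → Fn p
  isTrace s x y = χ≡ (dig s 0 y) (g y) * stepsOk s x y

  -- The digit x of any trace s < base ^ (x + 2) is rec g h x, so averaging over all of them yields it.
  recValue : Fn (suc p)
  recValue xy = quot (sumTo (λ s → isTrace s x y * dig s x y) range) (sumTo (λ s → isTrace s x y) range)
    where
    x = xy zero
    y = tail xy
    range = base y ^ suc (suc x)

  isTrace-sound : ∀ s x y → isTrace s x y ≢ 0 → ∀ t → t ≤ suc x → dig s t y ≡ rec g h t y
  isTrace-sound s x y T≢0 zero _ = χ≡≢0⇒≡ (λ χ≡0 → T≢0 (cong (_* stepsOk s x y) χ≡0))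
  isTrace-sound s x y T≢0 (suc t) (s≤s t≤x) =
    trans (χ≡≢0⇒≡ (prodTo≢0 _ x steps≢0 t t≤x)) (cong (λ d → h (t ∷ d ∷ y)) (isTrace-sound s x y T≢0 t (m≤n⇒m≤1+n t≤x)))
    where
    steps≢0 : stepsOk s x y ≢ 0
    steps≢0 S≡0 = T≢0 (trans (cong (χ≡ (dig s 0 y) (g y) *_) S≡0) (*-zeroʳ (χ≡ (dig s 0 y) (g y))))

  module _ (bounded : ∀ t y → rec g h t y ≤ b y) where

    values : ∀ x y → Fin (suc (suc x)) → ℕ
    values x y i = rec g h (toℕ i) y

    trace : ℕ → Fn p
    trace x y = horner (base y) (values x y)

    trace-digit : ∀ x y t → t ≤ suc x → dig (trace x y) t y ≡ rec g h t y
    trace-digit x y t t≤1+x = begin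
      dig (trace x y) t y                           ≡⟨ cong (λ i → dig (trace x y) i y) (toℕ-fromℕ< (s≤s t≤1+x)) ⟨
      dig (trace x y) (toℕ (fromℕ< (s≤s t≤1+x))) y ≡⟨ digit-horner (values x y) (λ i → s≤s (bounded (toℕ i) y)) (fromℕ< (s≤s t≤1+x)) ⟩
      rec g h (toℕ (fromℕ< (s≤s t≤1+x))) y         ≡⟨ cong (λ i → rec g h i y) (toℕ-fromℕ< (s≤s t≤1+x)) ⟩
      rec g h t y                                   ∎
      where open ≡-Reasoning

    isTrace-trace : ∀ x y → isTrace (trace x y) x y ≡ 1
    isTrace-trace x y = cong₂ _*_
      (trans (cong (λ d → χ≡ d (g y)) (trace-digit x y 0 z≤n)) (χ≡-refl (g y)))
      (prodTo-ones _ x λ t t≤x → trans (cong₂ (λ d d′ → χ≡ d (h (t ∷ d′ ∷ y)))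
                                              (trace-digit x y (suc t) (s≤s t≤x)) (trace-digit x y t (m≤n⇒m≤1+n t≤x)))
                                       (χ≡-refl (rec g h (suc t) y)))

    recValue≡rec : ∀ xy → recValue xy ≡ rec g h (xy zero) (tail xy)
    recValue≡rec xy = quot-weighted (λ s → isTrace s x y) (λ s → dig s x y) (rec g h x y) range agree
      (≤-trans (≤-reflexive (sym (isTrace-trace x y)))
               (sumTo-≤ (λ s → isTrace s x y) range (<⇒≤ (horner-< (values x y) (λ i → s≤s (bounded (toℕ i) y))))))
      where
      x = xy zero
      y = tail xy
      range = base y ^ suc (suc x)
      agree : ∀ s → isTrace s x y * dig s x y ≡ isTrace s x y * rec g h x y
      agree s with isTrace s x y ≟ 0
      ... | yes T≡0 rewrite T≡0 = refl
      ... | no  T≢0 = cong (isTrace s x y *_) (isTrace-sound s x y T≢0 x (n≤1+n x))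

  InE-recValue : InE p g → InE (suc (suc p)) h → InE p b → InE (suc p) recValue
  InE-recValue eg eh eb = InE-quot (InE-sumTo (InE-* isTraceI (digI (InE-π (suc zero)))) rangeI) (InE-sumTo isTraceI rangeI)
    where
    base₂ : InE (suc (suc p)) (λ sxy → base (tail (tail sxy)))
    base₂ = InE-weaken (InE-weaken (InE-suc eb))

    digI : ∀ {t : Fn (suc (suc p))} → InE _ t → InE (suc (suc p)) (λ sxy → dig (sxy zero) (t sxy) (tail (tail sxy)))
    digI et = InE-digit base₂ (InE-π zero) et

    stepI : InE (suc (suc (suc p)))
              (λ tsxy → χ≡ (dig (tsxy (suc zero)) (suc (tsxy zero)) (tail (tail (tail tsxy))))
                           (h (tsxy zero ∷ dig (tsxy (suc zero)) (tsxy zero) (tail (tail (tail tsxy))) ∷ tail (tail (tail tsxy)))))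
    stepI = InE-χ≡ (InE-digit base₃ (InE-π (suc zero)) (InE-suc (InE-π zero))) (InE-∘′ args eh argsI λ _ → λ
      { zero → refl ; (suc zero) → refl ; (suc (suc j)) → refl })
      where
      base₃ : InE (suc (suc (suc p))) (λ tsxy → base (tail (tail (tail tsxy))))
      base₃ = InE-weaken base₂
      args : Fin (suc (suc p)) → Fn (suc (suc (suc p)))
      args = (λ tsxy → tsxy zero) ∷ (λ tsxy → dig (tsxy (suc zero)) (tsxy zero) (tail (tail (tail tsxy))))
                                  ∷ (λ j tsxy → tsxy (suc (suc (suc j))))
      argsI : ∀ i → InE _ (args i)
      argsI zero          = InE-π zero
      argsI (suc zero)    = InE-digit base₃ (InE-π (suc zero)) (InE-π zero)
      argsI (suc (suc j)) = InE-π (suc (suc (suc j)))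

    isTraceI : InE (suc (suc p)) (λ sxy → isTrace (sxy zero) (sxy (suc zero)) (tail (tail sxy)))
    isTraceI = InE-* (InE-χ≡ (digI (InE-const 0)) (InE-weaken (InE-weaken eg))) (InE-prodTo stepI (InE-π (suc zero)))

    rangeI : InE (suc p) (λ xy → base (tail xy) ^ suc (suc (xy zero)))
    rangeI = InE-^ (InE-weaken (InE-suc eb)) (InE-suc (InE-suc (InE-π zero)))

InE-rec : ∀ {p} {g : Fn p} {h : Fn (suc (suc p))} {b : Fn p} → InE p g → InE (suc (suc p)) h → InE p b →
          (∀ t y → rec g h t y ≤ b y) → InE (suc p) (λ xy → rec g h (xy zero) (tail xy))
InE-rec {g = g} {h} {b} eg eh eb bounded = InE-≗ (InE-recValue eg eh eb) (recValue≡rec bounded)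
  where open BoundedRecursion g h b

-- Integers coded by natural numbers

code : ℤ → ℕ
code (+ n)    = n * 2
code -[1+ n ] = suc (n * 2)

half parity : ℕ → ℕ
half c   = quot c 2
parity c = rem c 2

half-+*2 : ∀ {a} n → a < 2 → half (a + n * 2) ≡ n
half-+*2 {a} n a<2 = trans (quot≡/ (a + n * 2) 2) ([a+h*B]/B≡h n a<2)

parity-+*2 : ∀ {a} n → a < 2 → parity (a + n * 2) ≡ a
parity-+*2 {a} n a<2 = trans (rem≡% (a + n * 2) 2) ([a+h*B]%B≡a n a<2)

pos neg : ℕ → ℕ
pos c = (1 ∸ parity c) * half c
neg c = parity c * half (suc c)

pos-+ : ∀ n → pos (code (+ n)) ≡ n
pos-+ n rewrite parity-+*2 {0} n (s≤s z≤n) | half-+*2 {0} n (s≤s z≤n) = +-identityʳ n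

neg-+ : ∀ n → neg (code (+ n)) ≡ 0
neg-+ n rewrite parity-+*2 {0} n (s≤s z≤n) = refl

pos-[1+] : ∀ n → pos (code -[1+ n ]) ≡ 0
pos-[1+] n rewrite parity-+*2 {1} n (s≤s (s≤s z≤n)) = refl

neg-[1+] : ∀ n → neg (code -[1+ n ]) ≡ suc n
neg-[1+] n rewrite parity-+*2 {1} n (s≤s (s≤s z≤n)) | half-+*2 {0} (suc n) (s≤s z≤n) = +-identityʳ (suc n)

pos-neg-decode : ∀ z → + pos (code z) ℤ.- + neg (code z) ≡ z
pos-neg-decode (+ n)    rewrite pos-+ n | neg-+ n = ℤ.+-identityʳ (+ n)
pos-neg-decode -[1+ n ] rewrite pos-[1+] n | neg-[1+] n = refl

pos+neg-code : ∀ z → pos (code z) + neg (code z) ≡ ∣ z ∣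
pos+neg-code (+ n)    rewrite pos-+ n | neg-+ n = +-identityʳ n
pos+neg-code -[1+ n ] rewrite pos-[1+] n | neg-[1+] n = refl

encode : ℕ → ℕ → ℕ
encode P Q = (P ∸ Q) * 2 + ((Q ∸ P) * 2 ∸ 1)

encode-⊖ : ∀ P Q → encode P Q ≡ code (P ⊖ Q)
encode-⊖ P Q with ≤-total Q P
... | inj₁ Q≤P rewrite ℤ.⊖-≥ Q≤P | m≤n⇒m∸n≡0 Q≤P = +-identityʳ _
... | inj₂ P≤Q with m≤n⇒m<n∨m≡n P≤Q
...   | inj₂ refl rewrite n∸n≡0 P | ℤ.n⊖n≡0 P = refl
...   | inj₁ P<Q rewrite ℤ.⊖-< P<Q | m≤n⇒m∸n≡0 P≤Q with Q ∸ P | m>n⇒m∸n≢0 P<Q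
...     | zero  | Q∸P≢0 = contradiction refl Q∸P≢0
...     | suc k | _     = refl

encode-code : ∀ {z} P Q → z ≡ + P ℤ.- + Q → encode P Q ≡ code z
encode-code P Q z≡P-Q = trans (encode-⊖ P Q) (cong code (trans (sym (ℤ.m-n≡m⊖n P Q)) (sym z≡P-Q)))

plusCode minusCode timesCode : ℕ → ℕ → ℕ
plusCode  c d = encode (pos c + pos d) (neg c + neg d)
minusCode c d = encode (pos c + neg d) (neg c + pos d)
timesCode c d = encode (pos c * pos d + neg c * neg d) (pos c * neg d + neg c * pos d)

private
  differences-add : ∀ A B C D → (A ℤ.- B) ℤ.+ (C ℤ.- D) ≡ (A ℤ.+ C) ℤ.- (B ℤ.+ D)
  differences-add = solve-∀
  differences-sub : ∀ A B C D → (A ℤ.- B) ℤ.- (C ℤ.- D) ≡ (A ℤ.+ D) ℤ.- (B ℤ.+ C)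
  differences-sub = solve-∀
  differences-mul : ∀ A B C D → (A ℤ.- B) ℤ.* (C ℤ.- D) ≡ (A ℤ.* C ℤ.+ B ℤ.* D) ℤ.- (A ℤ.* D ℤ.+ B ℤ.* C)
  differences-mul = solve-∀

module _ (a b : ℤ) where

  private
    pa = pos (code a); na = neg (code a); pb = pos (code b); nb = neg (code b)

    decode₂ : ∀ (_∙_ : ℤ → ℤ → ℤ) → a ∙ b ≡ (+ pa ℤ.- + na) ∙ (+ pb ℤ.- + nb)
    decode₂ _∙_ = sym (cong₂ _∙_ (pos-neg-decode a) (pos-neg-decode b))

    pos-+* : ∀ m n o q → + (m * n + o * q) ≡ + m ℤ.* + n ℤ.+ + o ℤ.* + q
    pos-+* m n o q = trans (ℤ.pos-+ (m * n) (o * q)) (cong₂ ℤ._+_ (ℤ.pos-* m n) (ℤ.pos-* o q))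

  plusCode-code : plusCode (code a) (code b) ≡ code (a ℤ.+ b)
  plusCode-code = encode-code (pa + pb) (na + nb) (begin
    a ℤ.+ b                             ≡⟨ decode₂ ℤ._+_ ⟩
    (+ pa ℤ.- + na) ℤ.+ (+ pb ℤ.- + nb) ≡⟨ differences-add (+ pa) (+ na) (+ pb) (+ nb) ⟩
    (+ pa ℤ.+ + pb) ℤ.- (+ na ℤ.+ + nb) ≡⟨ cong₂ ℤ._-_ (ℤ.pos-+ pa pb) (ℤ.pos-+ na nb) ⟨
    + (pa + pb) ℤ.- + (na + nb)         ∎)
    where open ≡-Reasoning

  minusCode-code : minusCode (code a) (code b) ≡ code (a ℤ.- b)
  minusCode-code = encode-code (pa + nb) (na + pb) (begin
    a ℤ.- b                             ≡⟨ decode₂ ℤ._-_ ⟩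
    (+ pa ℤ.- + na) ℤ.- (+ pb ℤ.- + nb) ≡⟨ differences-sub (+ pa) (+ na) (+ pb) (+ nb) ⟩
    (+ pa ℤ.+ + nb) ℤ.- (+ na ℤ.+ + pb) ≡⟨ cong₂ ℤ._-_ (ℤ.pos-+ pa nb) (ℤ.pos-+ na pb) ⟨
    + (pa + nb) ℤ.- + (na + pb)         ∎)
    where open ≡-Reasoning

  timesCode-code : timesCode (code a) (code b) ≡ code (a ℤ.* b)
  timesCode-code = encode-code (pa * pb + na * nb) (pa * nb + na * pb) (begin
    a ℤ.* b                             ≡⟨ decode₂ ℤ._*_ ⟩
    (+ pa ℤ.- + na) ℤ.* (+ pb ℤ.- + nb) ≡⟨ differences-mul (+ pa) (+ na) (+ pb) (+ nb) ⟩
    (+ pa ℤ.* + pb ℤ.+ + na ℤ.* + nb) ℤ.- (+ pa ℤ.* + nb ℤ.+ + na ℤ.* + pb)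
                                        ≡⟨ cong₂ ℤ._-_ (pos-+* pa pb na nb) (pos-+* pa nb na pb) ⟨
    + (pa * pb + na * nb) ℤ.- + (pa * nb + na * pb) ∎)
    where open ≡-Reasoning

InE-pos : ∀ {p} {c : Fn p} → InE p c → InE p (λ y → pos (c y))
InE-pos ec = InE-* (InE-∸ (InE-const 1) (InE-rem ec (InE-const 2))) (InE-quot ec (InE-const 2))

InE-neg : ∀ {p} {c : Fn p} → InE p c → InE p (λ y → neg (c y))
InE-neg ec = InE-* (InE-rem ec (InE-const 2)) (InE-quot (InE-suc ec) (InE-const 2))

InE-∣∣ : ∀ {p} (z : Fnℤ p) → InE p (λ y → code (z y)) → InE p (λ y → ∣ z y ∣)
InE-∣∣ z ez = InE-≗ (InE-+ (InE-pos ez) (InE-neg ez)) (λ y → pos+neg-code (z y))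

InE-encode : ∀ {p} {P Q : Fn p} → InE p P → InE p Q → InE p (λ y → encode (P y) (Q y))
InE-encode eP eQ = InE-+ (InE-* (InE-∸ eP eQ) (InE-const 2)) (InE-∸ (InE-* (InE-∸ eQ eP) (InE-const 2)) (InE-const 1))

InE-plusCode : ∀ {p} {c d : Fn p} → InE p c → InE p d → InE p (λ y → plusCode (c y) (d y))
InE-plusCode ec ed = InE-encode (InE-+ (InE-pos ec) (InE-pos ed)) (InE-+ (InE-neg ec) (InE-neg ed))

InE-minusCode : ∀ {p} {c d : Fn p} → InE p c → InE p d → InE p (λ y → minusCode (c y) (d y))
InE-minusCode ec ed = InE-encode (InE-+ (InE-pos ec) (InE-neg ed)) (InE-+ (InE-neg ec) (InE-pos ed))

InE-timesCode : ∀ {p} {c d : Fn p} → InE p c → InE p d → InE p (λ y → timesCode (c y) (d y))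
InE-timesCode ec ed = InE-encode (InE-+ (InE-* (InE-pos ec) (InE-pos ed)) (InE-* (InE-neg ec) (InE-neg ed)))
                                 (InE-+ (InE-* (InE-pos ec) (InE-neg ed)) (InE-* (InE-neg ec) (InE-pos ed)))

-- Growth of solutions of linear ODEs

sum-mono-≤ : ∀ {k} {f g : Fin k → ℕ} → (∀ i → f i ≤ g i) → sum f ≤ sum g
sum-mono-≤ {zero}  f≤g = z≤n
sum-mono-≤ {suc k} f≤g = +-mono-≤ (f≤g zero) (sum-mono-≤ (λ i → f≤g (suc i)))

term≤sum : ∀ {k} (f : Fin k → ℕ) i → f i ≤ sum f
term≤sum f zero    = m≤m+n _ _
term≤sum f (suc i) = ≤-trans (term≤sum (tail f) i) (m≤n+m _ _)

∣sumFin∣≤sum : ∀ {k} (v : Fin k → ℤ) → ∣ sumFin v ∣ ≤ ∑[ j < k ] ∣ v j ∣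
∣sumFin∣≤sum {zero}  v = z≤n
∣sumFin∣≤sum {suc k} v = ≤-trans (ℤ.∣i+j∣≤∣i∣+∣j∣ (v zero) _) (+-monoʳ-≤ ∣ v zero ∣ (∣sumFin∣≤sum (tail v)))

module GrowthBound {p k} (G : Fin k → Fn p) (A : Fin k → Fin k → Fnℤ (suc p)) (B : Fin k → Fnℤ (suc p))
                   (y : Fin p → ℕ) where

  f : ℕ → Fin k → ℤ
  f t = LIsol G A B t y

  norm : ℕ → ℕ
  norm t = ∑[ i < k ] ∣ f t i ∣

  row : ℕ → Fin k → ℕ
  row t i = ∑[ j < k ] ∣ A i j (t ∷ y) ∣

  α β : ℕ → ℕ
  α t = ∑[ i < k ] row t i
  β t = ∑[ i < k ] ∣ B i (t ∷ y) ∣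

  ∣f-suc∣≤ : ∀ t i → ∣ f (suc t) i ∣ ≤ ∣ f t i ∣ + (row t i * norm t + ∣ B i (t ∷ y) ∣)
  ∣f-suc∣≤ t i = begin
    ∣ f t i ℤ.+ (Σ ℤ.+ B i (t ∷ y)) ∣              ≤⟨ ℤ.∣i+j∣≤∣i∣+∣j∣ (f t i) _ ⟩
    ∣ f t i ∣ + ∣ Σ ℤ.+ B i (t ∷ y) ∣              ≤⟨ +-monoʳ-≤ ∣ f t i ∣ (ℤ.∣i+j∣≤∣i∣+∣j∣ Σ _) ⟩
    ∣ f t i ∣ + (∣ Σ ∣ + ∣ B i (t ∷ y) ∣)          ≤⟨ +-monoʳ-≤ ∣ f t i ∣ (+-monoˡ-≤ ∣ B i (t ∷ y) ∣ ∣Σ∣≤) ⟩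
    ∣ f t i ∣ + (row t i * norm t + ∣ B i (t ∷ y) ∣) ∎
    where
    open ≤-Reasoning
    Σ = sumFin (λ j → A i j (t ∷ y) ℤ.* f t j)
    ∣Σ∣≤ : ∣ Σ ∣ ≤ row t i * norm t
    ∣Σ∣≤ = begin
      ∣ Σ ∣                                           ≤⟨ ∣sumFin∣≤sum (λ j → A i j (t ∷ y) ℤ.* f t j) ⟩
      ∑[ j < k ] ∣ A i j (t ∷ y) ℤ.* f t j ∣          ≡⟨ sum-cong-≗ (λ j → ℤ.abs-* (A i j (t ∷ y)) (f t j)) ⟩
      ∑[ j < k ] (∣ A i j (t ∷ y) ∣ * ∣ f t j ∣)      ≤⟨ sum-mono-≤ (λ j → *-monoʳ-≤ ∣ A i j (t ∷ y) ∣ (term≤sum (λ j → ∣ f t j ∣) j)) ⟩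
      ∑[ j < k ] (∣ A i j (t ∷ y) ∣ * norm t)         ≡⟨ *-distribʳ-sum (norm t) (λ j → ∣ A i j (t ∷ y) ∣) ⟨
      row t i * norm t                                ∎

  norm-suc : ∀ t → suc (norm (suc t)) ≤ suc (norm t) * suc (α t + β t)
  norm-suc t = begin
    suc (norm (suc t))                                                ≤⟨ s≤s (sum-mono-≤ (∣f-suc∣≤ t)) ⟩
    suc (∑[ i < k ] (∣ f t i ∣ + (row t i * norm t + ∣ B i (t ∷ y) ∣))) ≡⟨ cong suc sums ⟩
    suc (norm t + (α t * norm t + β t))                               ≤⟨ m≤m+n _ (α t + β t * norm t) ⟩
    suc (norm t + (α t * norm t + β t)) + (α t + β t * norm t)        ≡⟨ expand (norm t) (α t) (β t) ⟩
    suc (norm t) * suc (α t + β t)                                    ∎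
    where
    open ≤-Reasoning
    sums : ∑[ i < k ] (∣ f t i ∣ + (row t i * norm t + ∣ B i (t ∷ y) ∣)) ≡ norm t + (α t * norm t + β t)
    sums = begin-equality
      ∑[ i < k ] (∣ f t i ∣ + (row t i * norm t + ∣ B i (t ∷ y) ∣))
        ≡⟨ ∑-distrib-+ (λ i → ∣ f t i ∣) _ ⟩
      norm t + ∑[ i < k ] (row t i * norm t + ∣ B i (t ∷ y) ∣)
        ≡⟨ cong (λ s → norm t + s) (∑-distrib-+ (λ i → row t i * norm t) _) ⟩
      norm t + (∑[ i < k ] (row t i * norm t) + β t)
        ≡⟨ cong (λ s → norm t + (s + β t)) (*-distribʳ-sum (norm t) (row t)) ⟨
      norm t + (α t * norm t + β t) ∎
    expand : ∀ n a b → suc (n + (a * n + b)) + (a + b * n) ≡ suc n * suc (a + b)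
    expand = ℕ-Solver.solve-∀

  growth : ℕ → ℕ
  growth zero    = suc (norm 0)
  growth (suc t) = growth t * suc (α t + β t)

  norm<growth : ∀ t → norm t < growth t
  norm<growth zero    = ≤-refl
  norm<growth (suc t) = ≤-trans (norm-suc t) (*-monoˡ-≤ (suc (α t + β t)) (norm<growth t))

  growth-mono : ∀ {t x} → t ≤ x → growth t ≤ growth x
  growth-mono {x = zero}  z≤n = ≤-refl
  growth-mono {x = suc x} t≤1+x with m≤n⇒m<n∨m≡n t≤1+x
  ... | inj₁ t<1+x = ≤-trans (growth-mono (m<1+n⇒m≤n t<1+x)) (m≤m*n (growth x) (suc (α x + β x)))
  ... | inj₂ refl  = ≤-refl

  ∣f∣<growth : ∀ {t x} → t ≤ x → ∀ i → ∣ f t i ∣ < growth x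
  ∣f∣<growth {t} t≤x i = <-≤-trans (≤-<-trans (term≤sum (λ i → ∣ f t i ∣) i) (norm<growth t)) (growth-mono t≤x)

  growth-prodTo : ∀ x → growth (suc x) ≡ growth 0 * prodTo (λ u → suc (α u + β u)) x
  growth-prodTo zero    = refl
  growth-prodTo (suc x) = trans (cong (_* suc (α (suc x) + β (suc x))) (growth-prodTo x))
                                (*-assoc (growth 0) (prodTo (λ u → suc (α u + β u)) x) (suc (α (suc x) + β (suc x))))

-- Elementarity of solutions of linear ODEs

sumCode : ∀ {k} → (Fin k → ℕ) → ℕ
sumCode {zero}  c = 0
sumCode {suc k} c = plusCode (c zero) (sumCode (tail c))

sumCode-cong : ∀ {k} {c c′ : Fin k → ℕ} → c ≗ c′ → sumCode c ≡ sumCode c′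
sumCode-cong {zero}  c≗c′ = refl
sumCode-cong {suc k} c≗c′ = cong₂ plusCode (c≗c′ zero) (sumCode-cong (λ j → c≗c′ (suc j)))

sumCode-code : ∀ {k} (v : Fin k → ℤ) → sumCode (λ j → code (v j)) ≡ code (sumFin v)
sumCode-code {zero}  v = refl
sumCode-code {suc k} v = trans (cong (plusCode (code (v zero))) (sumCode-code (tail v))) (plusCode-code (v zero) _)

InE-sumCode : ∀ {p k} {c : Fin k → Fn p} → (∀ j → InE p (c j)) → InE p (λ y → sumCode (λ j → c j y))
InE-sumCode {k = zero}  ec = InE-0
InE-sumCode {k = suc k} ec = InE-plusCode (ec zero) (InE-sumCode (λ j → ec (suc j)))

code≤∣∣*2 : ∀ z → code z ≤ ∣ z ∣ * 2
code≤∣∣*2 (+ n)    = ≤-refl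
code≤∣∣*2 -[1+ n ] = n≤1+n (suc (n * 2))

code< : ∀ {K} z → ∣ z ∣ < K → code z < suc (K * 2)
code< z ∣z∣<K = s≤s (≤-trans (code≤∣∣*2 z) (*-monoˡ-≤ 2 (<⇒≤ ∣z∣<K)))

module LISimulation {p k} (G : Fin k → Fn p) (A : Fin k → Fin k → Fnℤ (suc p)) (B : Fin k → Fnℤ (suc p)) where

  f : ℕ → (Fin p → ℕ) → Fin k → ℤ
  f t y = LIsol G A B t y

  bound : Fn (suc p)
  bound xy = GrowthBound.growth G A B (tail xy) (suc (xy zero))

  base : Fn (suc p)
  base xy = suc (bound xy * 2)

  codes : ℕ → Fn (suc p)
  codes t xy = horner (base xy) (λ i → code (f t (tail xy) i))

  nextCode : ℕ → ℕ → (Fin (suc p) → ℕ) → Fin k → ℕ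
  nextCode t s xy i = plusCode (dig i) (plusCode (sumCode (λ j → timesCode (code (A i j (t ∷ y))) (dig j))) (code (B i (t ∷ y))))
    where
    y = tail xy
    dig : Fin k → ℕ
    dig j = digit (base xy) s (toℕ j)

  -- Reducing each new digit modulo the base bounds the recursion for all t, not just t ≤ x.
  initial : Fn (suc p)
  initial xy = horner (base xy) (λ i → rem (code (+ G i (tail xy))) (base xy))

  step : Fn (suc (suc (suc p)))
  step tsxy = horner (base xy) (λ i → rem (nextCode (tsxy zero) (tsxy (suc zero)) xy i) (base xy))
    where xy = tail (tail tsxy)

  state : ℕ → Fn (suc p)
  state = rec initial step

  module _ (xy : Fin (suc p) → ℕ) where

    private
      x = xy zero
      y = tail xy

    code<base : ∀ {t} → t ≤ x → ∀ i → code (f t y i) < base xy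
    code<base {t} t≤x i = code< (f t y i) (GrowthBound.∣f∣<growth G A B y (m≤n⇒m≤1+n t≤x) i)

    nextCode-code : ∀ t s → (∀ j → digit (base xy) s (toℕ j) ≡ code (f t y j)) → ∀ i → nextCode t s xy i ≡ code (f (suc t) y i)
    nextCode-code t s digits i = begin
      nextCode t s xy i
        ≡⟨ cong₂ (λ d c → plusCode d (plusCode c (code (B i (t ∷ y))))) (digits i)
                 (sumCode-cong (λ j → trans (cong (timesCode (code (A i j (t ∷ y)))) (digits j)) (timesCode-code (A i j (t ∷ y)) (f t y j)))) ⟩
      plusCode (code (f t y i)) (plusCode (sumCode (λ j → code (A i j (t ∷ y) ℤ.* f t y j))) (code (B i (t ∷ y))))
        ≡⟨ cong (λ c → plusCode (code (f t y i)) (plusCode c (code (B i (t ∷ y))))) (sumCode-code (λ j → A i j (t ∷ y) ℤ.* f t y j)) ⟩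
      plusCode (code (f t y i)) (plusCode (code Σ) (code (B i (t ∷ y))))
        ≡⟨ cong (plusCode (code (f t y i))) (plusCode-code Σ (B i (t ∷ y))) ⟩
      plusCode (code (f t y i)) (code (Σ ℤ.+ B i (t ∷ y)))
        ≡⟨ plusCode-code (f t y i) (Σ ℤ.+ B i (t ∷ y)) ⟩
      code (f (suc t) y i) ∎
      where
      open ≡-Reasoning
      Σ = sumFin (λ j → A i j (t ∷ y) ℤ.* f t y j)

    state-codes : ∀ t → t ≤ x → state t xy ≡ codes t xy
    state-codes zero    0≤x   = horner-cong (base xy) (λ i → rem-small (code<base 0≤x i))
    state-codes (suc t) 1+t≤x = horner-cong (base xy) λ i →
      trans (cong (λ c → rem c (base xy)) (nextCode-code t (state t xy) digits i)) (rem-small (code<base 1+t≤x i))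
      where
      t≤x = ≤-trans (n≤1+n t) 1+t≤x
      digits : ∀ j → digit (base xy) (state t xy) (toℕ j) ≡ code (f t y j)
      digits j = trans (cong (λ s → digit (base xy) s (toℕ j)) (state-codes t t≤x))
                       (digit-horner (λ i → code (f t y i)) (code<base t≤x) j)

    state-< : ∀ t → state t xy < base xy ^ k
    state-< zero    = horner-< (λ i → rem (code (+ G i y)) (base xy)) (λ i → rem< (code (+ G i y)) (base xy))
    state-< (suc t) = horner-< (λ i → rem (nextCode t (state t xy) xy i) (base xy))
                               (λ i → rem< (nextCode t (state t xy) xy i) (base xy))

    state-digit : ∀ i → digit (base xy) (state x xy) (toℕ i) ≡ code (f x y i)
    state-digit i = trans (cong (λ s → digit (base xy) s (toℕ i)) (state-codes x ≤-refl))
                          (digit-horner (λ i → code (f x y i)) (code<base ≤-refl) i)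

  module _ (eG : ∀ i → InE p (G i)) (eA : ∀ i j → InE (suc p) (λ xy → code (A i j xy)))
           (eB : ∀ i → InE (suc p) (λ xy → code (B i xy))) where

    InE-bound : InE (suc p) bound
    InE-bound = InE-≗ growthI (λ xy → sym (GrowthBound.growth-prodTo G A B (tail xy) (xy zero)))
      where
      open GrowthBound G A B using (α; β)
      αI : InE (suc (suc p)) (λ uxy → α (tail (tail uxy)) (uxy zero))
      αI = InE-∑ λ i → InE-∑ λ j → InE-∣∣ (λ uxy → A i j (uxy zero ∷ tail (tail uxy))) (InE-skip₁ (eA i j))
      βI : InE (suc (suc p)) (λ uxy → β (tail (tail uxy)) (uxy zero))
      βI = InE-∑ λ i → InE-∣∣ (λ uxy → B i (uxy zero ∷ tail (tail uxy))) (InE-skip₁ (eB i))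
      growthI : InE (suc p) (λ xy → suc (∑[ i < k ] G i (tail xy)) * prodTo (λ u → suc (α (tail xy) u + β (tail xy) u)) (xy zero))
      growthI = InE-* (InE-suc (InE-∑ λ i → InE-weaken (eG i))) (InE-prodTo (InE-suc (InE-+ αI βI)) (InE-π zero))

    InE-base : InE (suc p) base
    InE-base = InE-suc (InE-* InE-bound (InE-const 2))

    InE-initial : InE (suc p) initial
    InE-initial = InE-horner InE-base λ i → InE-rem (InE-* (InE-weaken (eG i)) (InE-const 2)) InE-base

    InE-step : InE (suc (suc (suc p))) step
    InE-step = InE-horner base₂ λ i → InE-rem (nextCodeI i) base₂
      where
      base₂ : InE (suc (suc (suc p))) (λ tsxy → base (tail (tail tsxy)))
      base₂ = InE-weaken (InE-weaken InE-base)
      digI : ∀ j → InE (suc (suc (suc p))) (λ tsxy → digit (base (tail (tail tsxy))) (tsxy (suc zero)) (toℕ j))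
      digI j = InE-digit base₂ (InE-π (suc zero)) (InE-const (toℕ j))
      nextCodeI : ∀ i → InE (suc (suc (suc p))) (λ tsxy → nextCode (tsxy zero) (tsxy (suc zero)) (tail (tail tsxy)) i)
      nextCodeI i = InE-plusCode (digI i) (InE-plusCode
        (InE-sumCode λ j → InE-timesCode (InE-skip₁ (InE-skip₁ (eA i j))) (digI j)) (InE-skip₁ (InE-skip₁ (eB i))))

    InE-state : InE (suc p) (λ xy → state (xy zero) xy)
    InE-state = InE-∘′ {G = λ xy → xy zero ∷ xy} ((λ xy → xy zero) ∷ (λ j xy → xy j))
      (InE-rec InE-initial InE-step (InE-^ InE-base (InE-const k)) (λ t xy → <⇒≤ (state-< xy t)))
      (λ { zero → InE-π zero ; (suc j) → InE-π j }) (λ _ → λ { zero → refl ; (suc j) → refl })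

    InE-LIsol : ∀ i → InE (suc p) (λ xy → code (LIsol G A B (xy zero) (tail xy) i))
    InE-LIsol i = InE-≗ (InE-digit InE-base InE-state (InE-const (toℕ i))) (λ xy → state-digit xy i)

-- Functions of the linear-ODE class are elementary

codeSort : (s : Sort) → ⟦ s ⟧ → ℕ
codeSort N n = n
codeSort Z z = code z

codeEnv : ∀ {p} {σ : Fin p → Sort} → Env σ → Fin p → ℕ
codeEnv {σ = σ} e i = codeSort (σ i) (e i)

Coded : ∀ {p} (σ : Fin p → Sort) (s : Sort) → (Env σ → ⟦ s ⟧) → Set
Coded {p} σ s f = ∃ λ (r : Fn p) → InE p r × (∀ e → r (codeEnv e) ≡ codeSort s (f e))

InE-Coded : ∀ {p s} {f : (Fin p → ℕ) → ⟦ s ⟧} → Coded (λ _ → N) s f → InE p (λ y → codeSort s (f y))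
InE-Coded (r , er , r≡f) = InE-≗ er r≡f

pos-code : ∀ {z} → + 0 ℤ.≤ z → pos (code z) ≡ ∣ z ∣
pos-code {+ n} _ = pos-+ n

LIClass⇒Coded : ∀ {al p} {σ : Fin p → Sort} {s f} → LIClass al σ s f → Coded σ s f
LIClass⇒Coded zeroL     = _ , InE-0 , λ _ → refl
LIClass⇒Coded (projL i) = _ , InE-π i , λ _ → refl
LIClass⇒Coded succL     = _ , InE-suc (InE-π zero) , λ _ → refl
LIClass⇒Coded plusL     = _ , InE-plusCode (InE-π zero) (InE-π (suc zero)) , λ e → plusCode-code (e zero) (e (suc zero))
LIClass⇒Coded minusL    = _ , InE-minusCode (InE-π zero) (InE-π (suc zero)) , λ e → minusCode-code (e zero) (e (suc zero))
LIClass⇒Coded (toZ c) with LIClass⇒Coded c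
... | r , er , r≡f = _ , InE-* er (InE-const 2) , λ e → cong (_* 2) (r≡f e)
LIClass⇒Coded (toN {f = f} c 0≤f) with LIClass⇒Coded c
... | r , er , r≡f = _ , InE-pos er , λ e → trans (cong pos (r≡f e)) (pos-code (0≤f e))
LIClass⇒Coded (compL {g = g} ch cg) with LIClass⇒Coded ch
... | r , er , r≡h = _ , InE-∘ er (λ i → proj₁ (proj₂ (LIClass⇒Coded (cg i)))) ,
      λ e → trans (InE-cong er (λ i → proj₂ (proj₂ (LIClass⇒Coded (cg i))) e)) (r≡h (λ i → g i e))
LIClass⇒Coded (liL _ {G} {A} {B} cG cA cB i) =
  _ , LISimulation.InE-LIsol G A B (λ i → InE-Coded {s = N} (LIClass⇒Coded (cG i)))
                                   (λ i j → InE-Coded {s = Z} {f = A i j} (LIClass⇒Coded (cA i j)))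
                                   (λ i → InE-Coded {s = Z} {f = B i} (LIClass⇒Coded (cB i))) i , λ _ → refl

InLI⇒InE : ∀ {al p} (f : Fn p) → InLI al p f → InE p f
InLI⇒InE f (g , cg , g≗f) = InE-≗ (InE-Coded {s = N} (LIClass⇒Coded cg)) g≗f

-- Elementary functions belong to the scalar linear-ODE class

sumFin-cong : ∀ {k} {v w : Fin k → ℤ} → v ≗ w → sumFin v ≡ sumFin w
sumFin-cong {zero}  v≗w = refl
sumFin-cong {suc k} v≗w = cong₂ ℤ._+_ (v≗w zero) (sumFin-cong (λ j → v≗w (suc j)))

LIsol-cong : ∀ {p k} (G : Fin k → Fn p) (A : Fin k → Fin k → Fnℤ (suc p)) (B : Fin k → Fnℤ (suc p)) {y y′} →
             (∀ i → G i y ≡ G i y′) → (∀ t i j → A i j (t ∷ y) ≡ A i j (t ∷ y′)) → (∀ t i → B i (t ∷ y) ≡ B i (t ∷ y′)) →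
             ∀ x i → LIsol G A B x y i ≡ LIsol G A B x y′ i
LIsol-cong G A B G≡ A≡ B≡ zero    i = cong +_ (G≡ i)
LIsol-cong G A B G≡ A≡ B≡ (suc x) i =
  cong₂ ℤ._+_ (LIsol-cong G A B G≡ A≡ B≡ x i)
              (cong₂ ℤ._+_ (sumFin-cong (λ j → cong₂ ℤ._*_ (A≡ x i j) (LIsol-cong G A B G≡ A≡ B≡ x j))) (B≡ x i))

LIClass-cong : ∀ {al p} {σ : Fin p → Sort} {s f} → LIClass al σ s f → ∀ {e e′ : Env σ} → (∀ i → e i ≡ e′ i) → f e ≡ f e′
LIClass-cong zeroL         e≗e′ = refl
LIClass-cong (projL i)     e≗e′ = e≗e′ i
LIClass-cong succL         e≗e′ = cong suc (e≗e′ zero)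
LIClass-cong plusL         e≗e′ = cong₂ ℤ._+_ (e≗e′ zero) (e≗e′ (suc zero))
LIClass-cong minusL        e≗e′ = cong₂ ℤ._-_ (e≗e′ zero) (e≗e′ (suc zero))
LIClass-cong (toZ c)       e≗e′ = cong +_ (LIClass-cong c e≗e′)
LIClass-cong (toN c _)     e≗e′ = cong ∣_∣ (LIClass-cong c e≗e′)
LIClass-cong (compL ch cg) e≗e′ = LIClass-cong ch (λ i → LIClass-cong (cg i) e≗e′)
LIClass-cong (liL _ {G} {A} {B} cG cA cB i) {e} {e′} e≗e′ =
  trans (LIsol-cong G A B (λ i → LIClass-cong (cG i) (λ j → e≗e′ (suc j)))
                          (λ t i j → LIClass-cong (cA i j) (∷-cong t (λ j → e≗e′ (suc j))))
                          (λ t i → LIClass-cong (cB i) (∷-cong t (λ j → e≗e′ (suc j)))) (e zero) i)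
        (cong (λ x → LIsol G A B x (tail e′) i) (e≗e′ zero))

InLIₛ : (ℕ → Set) → ∀ p (s : Sort) → ((Fin p → ℕ) → ⟦ s ⟧) → Set
InLIₛ al p s f = ∃ λ g → LIClass al (λ _ → N) s g × (∀ y → g y ≡ f y)

module _ {al : ℕ → Set} where

  InLI-≗ : ∀ {p s} {f f′ : (Fin p → ℕ) → ⟦ s ⟧} → InLIₛ al p s f → f ≗ f′ → InLIₛ al p s f′
  InLI-≗ (g , cg , g≗f) f≗f′ = g , cg , λ y → trans (g≗f y) (f≗f′ y)

  InLI-cong : ∀ {p s} {f : (Fin p → ℕ) → ⟦ s ⟧} → InLIₛ al p s f → ∀ {y y′} → y ≗ y′ → f y ≡ f y′
  InLI-cong (g , cg , g≗f) {y} {y′} y≗y′ = trans (sym (g≗f y)) (trans (LIClass-cong cg y≗y′) (g≗f y′))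

  InLI-∘ : ∀ {m p s} {h : (Fin m → ℕ) → ⟦ s ⟧} {g : Fin m → Fn p} →
           InLIₛ al m s h → (∀ i → InLI al p (g i)) → InLIₛ al p s (λ y → h (λ i → g i y))
  InLI-∘ (h′ , ch , h′≗h) cg =
    _ , compL ch (λ i → proj₁ (proj₂ (cg i))) , λ y → trans (LIClass-cong ch (λ i → proj₂ (proj₂ (cg i)) y)) (h′≗h _)

  InLI-∘′ : ∀ {m p s} {h : (Fin m → ℕ) → ⟦ s ⟧} {G : (Fin p → ℕ) → Fin m → ℕ} (g : Fin m → Fn p) →
            InLIₛ al m s h → (∀ i → InLI al p (g i)) → (∀ y → (λ i → g i y) ≗ G y) → InLIₛ al p s (λ y → h (G y))
  InLI-∘′ g ch cg g≗G = InLI-≗ (InLI-∘ {g = g} ch cg) (λ y → InLI-cong ch (g≗G y))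

  InLI-0 : ∀ {p} → InLI al p (λ _ → 0)
  InLI-0 = _ , zeroL , λ _ → refl

  InLI-π : ∀ {p} (i : Fin p) → InLI al p (λ y → y i)
  InLI-π i = _ , projL i , λ _ → refl

  InLI-suc : ∀ {p} {a : Fn p} → InLI al p a → InLI al p (λ y → suc (a y))
  InLI-suc {a = a} ca = InLI-∘ {g = a ∷ []} (_ , succL , λ _ → refl) λ { zero → ca }

  InLI-1 : ∀ {p} → InLI al p (λ _ → 1)
  InLI-1 = InLI-suc InLI-0

  InLI-toℤ : ∀ {p} {a : Fn p} → InLI al p a → InLIₛ al p Z (λ y → + a y)
  InLI-toℤ (g , cg , g≗a) = _ , toZ cg , λ y → cong +_ (g≗a y)

  InLI-∣∣ : ∀ {p} {a : Fnℤ p} → InLIₛ al p Z a → (∀ y → + 0 ℤ.≤ a y) → InLI al p (λ y → ∣ a y ∣)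
  InLI-∣∣ (g , cg , g≗a) 0≤a = _ , toN cg (λ y → subst (+ 0 ℤ.≤_) (sym (g≗a y)) (0≤a y)) , λ y → cong ∣_∣ (g≗a y)

  private
    InLI-ℤ-op : ∀ {p} {op : ℤ → ℤ → ℤ} → LIClass al {2} (λ _ → Z) Z (λ e → op (e zero) (e (suc zero))) →
                ∀ {a b : Fnℤ p} → InLIₛ al p Z a → InLIₛ al p Z b → InLIₛ al p Z (λ y → op (a y) (b y))
    InLI-ℤ-op {op = op} cop (ga , ca , ga≗a) (gb , cb , gb≗b) =
      _ , compL {τ = λ _ → Z} {g = ga ∷ gb ∷ []} cop (λ { zero → ca ; (suc zero) → cb }) , λ y → cong₂ op (ga≗a y) (gb≗b y)

  InLI-plus : ∀ {p} {a b : Fnℤ p} → InLIₛ al p Z a → InLIₛ al p Z b → InLIₛ al p Z (λ y → a y ℤ.+ b y)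
  InLI-plus = InLI-ℤ-op {op = ℤ._+_} plusL

  InLI-minus : ∀ {p} {a b : Fnℤ p} → InLIₛ al p Z a → InLIₛ al p Z b → InLIₛ al p Z (λ y → a y ℤ.- b y)
  InLI-minus = InLI-ℤ-op {op = ℤ._-_} minusL

  InLI-at0 : ∀ {p} {g : Fn (suc p)} → InLI al (suc p) g → InLI al p (λ y → g (0 ∷ y))
  InLI-at0 cg = InLI-∘′ ((λ _ → 0) ∷ (λ j y → y j)) cg (λ { zero → InLI-0 ; (suc j) → InLI-π j })
                        (λ _ → λ { zero → refl ; (suc j) → refl })

  InLI-atSuc : ∀ {p} {g : Fn (suc p)} → InLI al (suc p) g → InLI al (suc p) (λ xy → g (suc (xy zero) ∷ tail xy))
  InLI-atSuc cg = InLI-∘′ ((λ xy → suc (xy zero)) ∷ (λ j xy → xy (suc j))) cg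
                          (λ { zero → InLI-suc (InLI-π zero) ; (suc j) → InLI-π (suc j) })
                          (λ _ → λ { zero → refl ; (suc j) → refl })

  module _ (scalar : al 1) where

    LIsol-scalar : ∀ {p} (G : Fin 1 → Fn p) (A : Fin 1 → Fin 1 → Fnℤ (suc p)) B y (F : ℕ → ℤ) →
                   + G zero y ≡ F 0 → (∀ t → F (suc t) ≡ F t ℤ.+ (A zero zero (t ∷ y) ℤ.* F t ℤ.+ B zero (t ∷ y))) →
                   ∀ x → LIsol G A B x y zero ≡ F x
    LIsol-scalar G A B y F G≡F₀ F-suc zero    = G≡F₀
    LIsol-scalar G A B y F G≡F₀ F-suc (suc x) = begin
      LIsol G A B x y zero ℤ.+ ((A zero zero (x ∷ y) ℤ.* LIsol G A B x y zero ℤ.+ + 0) ℤ.+ B zero (x ∷ y))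
        ≡⟨ cong (λ v → v ℤ.+ ((A zero zero (x ∷ y) ℤ.* v ℤ.+ + 0) ℤ.+ B zero (x ∷ y))) IH ⟩
      F x ℤ.+ ((A zero zero (x ∷ y) ℤ.* F x ℤ.+ + 0) ℤ.+ B zero (x ∷ y))
        ≡⟨ cong (λ v → F x ℤ.+ (v ℤ.+ B zero (x ∷ y))) (ℤ.+-identityʳ (A zero zero (x ∷ y) ℤ.* F x)) ⟩
      F x ℤ.+ (A zero zero (x ∷ y) ℤ.* F x ℤ.+ B zero (x ∷ y))
        ≡⟨ F-suc x ⟨
      F (suc x) ∎
      where
      open ≡-Reasoning
      IH = LIsol-scalar G A B y F G≡F₀ F-suc x

    InLI-ODE : ∀ {p} {g₀ : Fn p} {a b : Fnℤ (suc p)} (F : ℕ → Fnℤ p) →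
               InLI al p g₀ → InLIₛ al (suc p) Z a → InLIₛ al (suc p) Z b →
               (∀ y → + g₀ y ≡ F 0 y) → (∀ t y → F (suc t) y ≡ F t y ℤ.+ (a (t ∷ y) ℤ.* F t y ℤ.+ b (t ∷ y))) →
               InLIₛ al (suc p) Z (λ xy → F (xy zero) (tail xy))
    InLI-ODE F (g′ , cg , g′≗g₀) (a′ , ca , a′≗a) (b′ , cb , b′≗b) g₀≡F₀ F-suc =
      _ , liL scalar {G = λ _ → g′} {A = λ _ _ → a′} {B = λ _ → b′} (λ _ → cg) (λ _ _ → ca) (λ _ → cb) zero ,
      λ xy → LIsol-scalar _ _ _ (tail xy) (λ t → F t (tail xy)) (trans (cong +_ (g′≗g₀ (tail xy))) (g₀≡F₀ (tail xy)))
               (λ t → trans (F-suc t (tail xy)) (cong₂ (λ u v → F t (tail xy) ℤ.+ (u ℤ.* F t (tail xy) ℤ.+ v))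
                                                       (sym (a′≗a _)) (sym (b′≗b _))))
               (xy zero)

    InLI-1∸ : ∀ {p} {a : Fn p} → InLI al p a → InLI al p (λ y → 1 ∸ a y)
    InLI-1∸ {a = a} ca = InLI-∘ {g = a ∷ []} (InLI-∣∣ 1∸x (λ _ → +≤+ z≤n)) λ { zero → ca }
      where
      1∸-suc : ∀ t → + (1 ∸ suc t) ≡ + (1 ∸ t) ℤ.+ ((+ 0 ℤ.- + 1) ℤ.* + (1 ∸ t) ℤ.+ + 0)
      1∸-suc zero    = refl
      1∸-suc (suc t) rewrite 0∸n≡0 t = refl
      1∸x : InLIₛ al 1 Z (λ xy → + (1 ∸ xy zero))
      1∸x = InLI-ODE (λ x _ → + (1 ∸ x)) InLI-1 (InLI-minus (InLI-toℤ InLI-0) (InLI-toℤ InLI-1)) (InLI-toℤ InLI-0)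
                     (λ _ → refl) (λ t _ → 1∸-suc t)

    InLI-scaledDifference : InLIₛ al 3 Z (λ v → + v zero ℤ.* (+ v (suc zero) ℤ.- + v (suc (suc zero))))
    InLI-scaledDifference = InLI-ODE (λ c y → + c ℤ.* (+ y zero ℤ.- + y (suc zero))) InLI-0 (InLI-toℤ InLI-0)
                       (InLI-minus (InLI-toℤ (InLI-π (suc zero))) (InLI-toℤ (InLI-π (suc (suc zero)))))
                       (λ _ → refl) (λ t y → distrib (+ t) (+ y zero ℤ.- + y (suc zero)))
      where
      distrib : ∀ T d → (+ 1 ℤ.+ T) ℤ.* d ≡ T ℤ.* d ℤ.+ (+ 0 ℤ.* (T ℤ.* d) ℤ.+ d)
      distrib = solve-∀

    -- Without truncated subtraction, equality is tested through the nonnegative (u - v)².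
    InLI-χ≡ : ∀ {p} {a b : Fn p} → InLI al p a → InLI al p b → InLI al p (λ y → χ≡ (a y) (b y))
    InLI-χ≡ {a = a} {b} ca cb =
      InLI-≗ (InLI-1∸ (InLI-∘ {g = a ∷ b ∷ []} (InLI-∣∣ square (λ v → square≥0 (+ v zero ℤ.- + v (suc zero))))
                                               λ { zero → ca ; (suc zero) → cb }))
             (λ y → 1∸∣square∣ (a y) (b y))
      where
      square : InLIₛ al 2 Z (λ v → (+ v zero ℤ.- + v (suc zero)) ℤ.* (+ v zero ℤ.- + v (suc zero)))
      square = InLI-≗ (InLI-minus (InLI-∘ {g = (λ v → v zero) ∷ (λ v → v zero) ∷ (λ v → v (suc zero)) ∷ []} InLI-scaledDifference
                                  λ { zero → InLI-π zero ; (suc zero) → InLI-π zero ; (suc (suc zero)) → InLI-π (suc zero) })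
                               (InLI-∘ {g = (λ v → v (suc zero)) ∷ (λ v → v zero) ∷ (λ v → v (suc zero)) ∷ []} InLI-scaledDifference
                                  λ { zero → InLI-π (suc zero) ; (suc zero) → InLI-π zero ; (suc (suc zero)) → InLI-π (suc zero) }))
                      (λ v → factor (+ v zero) (+ v (suc zero)))
        where
        factor : ∀ u w → u ℤ.* (u ℤ.- w) ℤ.- w ℤ.* (u ℤ.- w) ≡ (u ℤ.- w) ℤ.* (u ℤ.- w)
        factor = solve-∀
      square≥0 : ∀ d → + 0 ℤ.≤ d ℤ.* d
      square≥0 (+ n)    = subst (+ 0 ℤ.≤_) (ℤ.pos-* n n) (+≤+ z≤n)
      square≥0 -[1+ n ] = +≤+ z≤n
      1∸∣square∣ : ∀ u v → 1 ∸ ∣ (+ u ℤ.- + v) ℤ.* (+ u ℤ.- + v) ∣ ≡ χ≡ u v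
      1∸∣square∣ u v with u ≟ v
      ... | yes refl rewrite ℤ.+-inverseʳ (+ u) = sym (χ≡-refl u)
      ... | no  u≢v  = begin
        1 ∸ ∣ d ℤ.* d ∣   ≡⟨ cong (1 ∸_) (ℤ.abs-* d d) ⟩
        1 ∸ ∣ d ∣ * ∣ d ∣ ≡⟨ m≤n⇒m∸n≡0 (*-mono-≤ 0<∣d∣ 0<∣d∣) ⟩
        0                 ≡⟨ χ≡-≢ u≢v ⟨
        χ≡ u v            ∎
        where
        open ≡-Reasoning
        d = + u ℤ.- + v
        0<∣d∣ : 0 < ∣ d ∣
        0<∣d∣ = n≢0⇒n>0 (λ ∣d∣≡0 → u≢v (ℤ.+-injective (ℤ.i-j≡0⇒i≡j (+ u) (+ v) (ℤ.∣i∣≡0⇒i≡0 ∣d∣≡0))))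

    χ≤-suc : ∀ b t → χ≤ b (suc t) ≡ χ≤ b t + χ≡ (suc t) b
    χ≤-suc b t with <-cmp b (suc t)
    ... | tri< b<1+t _ _ = trans (χ≤-yes (<⇒≤ b<1+t))
                                 (sym (cong₂ _+_ (χ≤-yes (m<1+n⇒m≤n b<1+t)) (χ≡-≢ (<⇒≢ b<1+t ∘ sym))))
    ... | tri≈ _ refl _  = trans (χ≤-yes (≤-refl {b})) (sym (cong₂ _+_ (χ≤-no (n<1+n t)) (χ≡-refl b)))
    ... | tri> _ _ 1+t<b = trans (χ≤-no 1+t<b) (sym (cong₂ _+_ (χ≤-no (<-trans (n<1+n t) 1+t<b)) (χ≡-≢ (<⇒≢ 1+t<b))))

    InLI-χ≤ : InLIₛ al 2 Z (λ xb → + χ≤ (xb (suc zero)) (xb zero))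
    InLI-χ≤ = InLI-ODE (λ x y → + χ≤ (y zero) x) (InLI-1∸ (InLI-π zero)) (InLI-toℤ InLI-0)
                       (InLI-toℤ (InLI-χ≡ (InLI-suc (InLI-π zero)) (InLI-π (suc zero))))
                       (λ _ → refl) (λ t y → cong +_ (χ≤-suc (y zero) t))

    ∸-suc : ∀ b t → suc t ∸ b ≡ (t ∸ b) + χ≤ b t
    ∸-suc b t with b ≤? t
    ... | yes b≤t = trans (+-∸-assoc 1 b≤t) (trans (+-comm 1 (t ∸ b)) (sym (cong (λ c → (t ∸ b) + c) (χ≤-yes b≤t))))
    ... | no  b≰t = trans (m≤n⇒m∸n≡0 (≰⇒> b≰t)) (sym (cong₂ _+_ (m≤n⇒m∸n≡0 (<⇒≤ (≰⇒> b≰t))) (χ≤-no (≰⇒> b≰t))))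

    InLI-∸ : InLI al 2 (λ y → y zero ∸ y (suc zero))
    InLI-∸ = InLI-∣∣ (InLI-ODE (λ x y → + (x ∸ y zero)) InLI-0 (InLI-toℤ InLI-0) InLI-χ≤
                               (λ y → cong +_ (sym (0∸n≡0 (y zero)))) (λ t y → cong +_ (∸-suc (y zero) t)))
                     (λ _ → +≤+ z≤n)

    Elem⇒InLI : ∀ {p g} → Elem p g → InLI al p g
    Elem⇒InLI zeroE        = InLI-0
    Elem⇒InLI (projE i)    = InLI-π i
    Elem⇒InLI succE        = InLI-suc (InLI-π zero)
    Elem⇒InLI addE         = InLI-∣∣ (InLI-plus (InLI-toℤ (InLI-π zero)) (InLI-toℤ (InLI-π (suc zero)))) (λ _ → +≤+ z≤n)
    Elem⇒InLI monusE       = InLI-∸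
    Elem⇒InLI (compE h gs) = InLI-∘ (Elem⇒InLI h) (λ i → Elem⇒InLI (gs i))
    Elem⇒InLI (bsumE {g = g} e) =
      InLI-∣∣ (InLI-ODE (λ x y → + sumTo (λ z → g (z ∷ y)) x) (InLI-at0 cg) (InLI-toℤ InLI-0) (InLI-toℤ (InLI-atSuc cg))
                        (λ _ → refl) (λ _ _ → refl))
              (λ _ → +≤+ z≤n)
      where cg = Elem⇒InLI e
    Elem⇒InLI (bprodE {g = g} e) =
      InLI-∣∣ (InLI-ODE (λ x y → + prodTo (λ z → g (z ∷ y)) x) (InLI-at0 cg) (InLI-minus (InLI-toℤ (InLI-atSuc cg)) (InLI-toℤ InLI-1))
                        (InLI-toℤ InLI-0) (λ _ → refl)
                        (λ t y → trans (ℤ.pos-* (prodTo (λ z → g (z ∷ y)) t) (g (suc t ∷ y)))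
                                       (prodTo-step (+ prodTo (λ z → g (z ∷ y)) t) (+ g (suc t ∷ y)))))
              (λ _ → +≤+ z≤n)
      where
      cg = Elem⇒InLI e
      prodTo-step : ∀ P c → P ℤ.* c ≡ P ℤ.+ ((c ℤ.- + 1) ℤ.* P ℤ.+ + 0)
      prodTo-step = solve-∀

    InE⇒InLI : ∀ {p} (f : Fn p) → InE p f → InLI al p f
    InE⇒InLI f (g , eg , g≗f) = InLI-≗ (Elem⇒InLI eg) g≗f

mainTheorem2 : (∀ p (f : (Fin p → ℕ) → ℕ) → InE p f ⇔ InLI Vectorial p f)
               × (∀ p (f : (Fin p → ℕ) → ℕ) → InE p f ⇔ InLI Scalar p f)
mainTheorem2 = (λ p f → mk⇔ (InE⇒InLI tt f) (InLI⇒InE f))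
             , (λ p f → mk⇔ (InE⇒InLI refl f) (InLI⇒InE f))
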